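{- Let $\mathbf A$ be an Almost Gautama algebra and $x\in A$. Then $(x\land x'^*)\lor(x\land x'^*)^*=1$.
   Context: An Almost Gautama algebra is an algebra $\mathbf A=\langle A,\lor,\land,{}^*,{}',0,1\rangle$ such that: (a) $\langle A,\lor,\land,{}^*,0,1\rangle$ is a Stone algebra (a bounded distributive lattice with pseudocomplement ${}^*$ satisfying $x^*\lor x^{**}\approx 1$); (b) $\langle A,\lor,\land,{}',0,1\rangle$ is a dually quasi-De Morgan algebra: a bounded distributive lattice with $0'\approx1$, $1'\approx0$, $(x\land y)'\approx x'\lor y'$, $(x\lor y)''\approx x''\lor y''$, $x''\le x$; (c) $x\land x'{}^*{}'\le y\lor y^*$; (d) $x^*{}''\approx x^*$; (e) $(x\land x'^*)'^*\approx x\land x'^*$. Here $x'^*$ means $(x')^*$ etc. -}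

module Defs where

open import Level using (Level; suc; _⊔_)
open import Relation.Binary.PropositionalEquality using (_≡_)
open import Algebra.Lattice.Structures using (IsDistributiveLattice)
open import Function.Bundles using (_⇔_)

record AlmostGautama (a : Level) : Set (suc a) where
  infixr 6 _∨_
  infixr 7 _∧_
  infix 4 _≤_
  field
    Carrier : Set a
    _∨_ _∧_ : Carrier → Carrier → Carrier
    _* _′ : Carrier → Carrier
    𝟎 𝟏 : Carrier

  _≤_ : Carrier → Carrier → Set a
  x ≤ y = x ∧ y ≡ x

  field
    isDistributiveLattice : IsDistributiveLattice _≡_ _∨_ _∧_
    ∧-bot : ∀ x → 𝟎 ∧ x ≡ 𝟎
    ∨-top : ∀ x → 𝟏 ∨ x ≡ 𝟏
    pseudocomplement : ∀ x y → (x ∧ y ≡ 𝟎) ⇔ (y ≤ x *)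
    stone : ∀ x → (x *) ∨ ((x *) *) ≡ 𝟏
    0′ : 𝟎 ′ ≡ 𝟏
    1′ : 𝟏 ′ ≡ 𝟎
    ∧′ : ∀ x y → (x ∧ y) ′ ≡ (x ′) ∨ (y ′)
    ∨′′ : ∀ x y → ((x ∨ y) ′) ′ ≡ ((x ′) ′) ∨ ((y ′) ′)
    ′′≤ : ∀ x → (x ′) ′ ≤ x
    axC : ∀ x y → x ∧ (((x ′) *) ′) ≤ y ∨ (y *)
    axD : ∀ x → ((x *) ′) ′ ≡ x *
    axE : ∀ x → (((x ∧ ((x ′) *)) ′) *) ≡ x ∧ ((x ′) *)

module Submission where

open import Defs
open import Level using (Level)
open import Relation.Binary.PropositionalEquality using (_≡_; subst)

module _ {a : Level} (A : AlmostGautama a) where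
  open AlmostGautama A

  *-image-complemented : ∀ {w} y → y * ≡ w → w ∨ w * ≡ 𝟏
  *-image-complemented y y*≡w = subst (λ v → v ∨ v * ≡ 𝟏) y*≡w (stone y)

lemma3p14 : ∀ {a : Level} (A : AlmostGautama a) → let open AlmostGautama A in
    ∀ (x : Carrier) → (x ∧ ((x ′) *)) ∨ ((x ∧ ((x ′) *)) *) ≡ 𝟏
lemma3p14 A x = *-image-complemented A ((x ∧ ((x ′) *)) ′) (axE x)
  where open AlmostGautama A
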